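{- For every $n\ge1$ and every signed permutation $\pi\in\mathfrak{B}_n$, \[\sum_{k\ge0}\Omega'_B(\pi;k)\,t^k=\frac{(1+t)^n}{(1-t)^{n+1}}\left(\frac{2t}{1+t}\right)^{\varsigma(\pi)}\left(\frac{4t}{(1+t)^2}\right)^{\mathrm{pe}_B(\pi)}.\]
   Context: $\mathfrak{B}_n$ is the group of signed permutations: bijections $\pi$ of $\{ -n,\dots,n\}$ with $\pi(-i)=-\pi(i)$ (so $\pi(0)=0$). $\mathrm{Des}_B(\pi)=\{i\in\{0,\dots,n-1\}:\pi(i)>\pi(i+1)\}$. A peak is a position $i\in\{1,\dots,n-1\}$ with $\pi(i-1)<\pi(i)>\pi(i+1)$; $\mathrm{pe}_B(\pi)$ is their number. $\varsigma(\pi)=0$ if $\pi(1)>0$ and $\varsigma(\pi)=1$ if $\pi(1)<0$. For $k\ge0$ let $T_k=\{0,1^{ -1},1,2^{ -1},2,\dots,k^{ -1},k\}$ be totally ordered as listed, with $\varepsilon(0)=\varepsilon(j)=1$, $\varepsilon(j^{ -1})=-1$. Write $a\le^+b$ if $a<b$ or ($a=b$, $\varepsilon(a)=1$), and $a\le^-b$ if $a<b$ or ($a=b$, $\varepsilon(a)=-1$). $\Omega'_B(\pi;k)$ is the number of $(a_1,\dots,a_n)\in T_k^n$ such that, with $a_0=0$, for each $s\in\{0,\dots,n-1\}$, $a_s\le^+a_{s+1}$ if $s\notin\mathrm{Des}_B(\pi)$ and $a_s\le^-a_{s+1}$ if $s\in\mathrm{Des}_B(\pi)$. -}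

module Defs where

open import Data.Bool using (Bool; true; false; if_then_else_; _∧_; _∨_; not)
open import Data.Nat as ℕ using (ℕ; zero; suc; _∸_)
import Data.Nat.Properties as ℕP
open import Data.Fin as Fin using (Fin; toℕ; fromℕ<)
open import Data.Fin.Permutation using (Permutation′; _⟨$⟩ʳ_)
open import Data.Integer as ℤ using (ℤ; +_; -[1+_])
import Data.Integer.Properties as ℤP
open import Data.List using (List; []; _∷_; upTo; map; concatMap; length; filterᵇ; sum)
open import Data.Bool.ListAction using (and)
open import Data.Vec as Vec using (Vec; []; _∷_; lookup)
open import Data.Product using (_×_; _,_; proj₁; proj₂)
open import Relation.Nullary using (does; yes; no)

-- A signed permutation π ∈ 𝔅_n is determined by the permutation
-- σ of {1..n} given by i ↦ |π(i)| and the signs of π(1),…,π(n).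
-- Here Fin n indexes {1..n} (index j stands for j+1); sign true = negative.

SignedPerm : ℕ → Set
SignedPerm n = Permutation′ n × (Fin n → Bool)

entry : ∀ {n} → SignedPerm n → Fin n → ℤ
entry (σ , neg) j =
  if neg j then -[1+ toℕ (σ ⟨$⟩ʳ j) ] else + suc (toℕ (σ ⟨$⟩ʳ j))

-- π(i) for i ∈ {0..n} (π(0) = 0); values for i > n are irrelevant (set to 0)
val : ∀ {n} → SignedPerm n → ℕ → ℤ
val π zero = + 0
val {n} π (suc i) with i ℕ.<? n
... | yes p = entry π (fromℕ< p)
... | no _  = + 0

_<ᵇℤ_ : ℤ → ℤ → Bool
x <ᵇℤ y = does (x ℤ.<? y)

infix 4 _<ᵇℤ_

isDes : ∀ {n} → SignedPerm n → ℕ → Bool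
isDes π s = val π (suc s) <ᵇℤ val π s

isPeak : ∀ {n} → SignedPerm n → ℕ → Bool
isPeak π i = (val π (i ∸ 1) <ᵇℤ val π i) ∧ (val π (suc i) <ᵇℤ val π i)

peB : ∀ {n} → SignedPerm n → ℕ
peB {n} π = length (filterᵇ (isPeak π) (map suc (upTo (n ∸ 1))))

vsig : ∀ {n} → SignedPerm n → ℕ
vsig π = if val π 1 <ᵇℤ + 0 then 1 else 0

-- The totally ordered set T_k = {0, 1⁻¹, 1, 2⁻¹, 2, …, k⁻¹, k},
-- encoded as Fin (2k+1) listed in order: index 0 ↦ 0, 2j-1 ↦ j⁻¹, 2j ↦ j.
-- Hence ε(x) = 1 iff the index of x is even.

T : ℕ → Set
T k = Fin (suc (2 ℕ.* k))

εpos : ∀ {m} → Fin m → Bool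
εpos x = does (toℕ x ℕ.% 2 ℕ.≟ 0)

_<ᵀ_ : ∀ {m} → Fin m → Fin m → Bool
a <ᵀ b = does (toℕ a ℕ.<? toℕ b)

_=ᵀ_ : ∀ {m} → Fin m → Fin m → Bool
a =ᵀ b = does (toℕ a ℕ.≟ toℕ b)

infix 4 _<ᵀ_ _=ᵀ_ _≤⁺_ _≤⁻_

_≤⁺_ : ∀ {m} → Fin m → Fin m → Bool
a ≤⁺ b = (a <ᵀ b) ∨ ((a =ᵀ b) ∧ εpos a)

_≤⁻_ : ∀ {m} → Fin m → Fin m → Bool
a ≤⁻ b = (a <ᵀ b) ∨ ((a =ᵀ b) ∧ not (εpos a))

allVecs : ∀ {A : Set} → List A → (n : ℕ) → List (Vec A n)
allVecs xs zero = [] ∷ []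
allVecs xs (suc n) = concatMap (λ x → map (x ∷_) (allVecs xs n)) xs

allT : (k : ℕ) → List (T k)
allT k = Data.List.allFin (suc (2 ℕ.* k))
  where import Data.List

aAt : ∀ {m n} → Vec (Fin (suc m)) n → ℕ → Fin (suc m)
aAt a zero = Fin.zero
aAt {n = n} a (suc j) with j ℕ.<? n
... | yes p = lookup a (fromℕ< p)
... | no _  = Fin.zero

admissible : ∀ {n} k → SignedPerm n → Vec (T k) n → Bool
admissible {n} k π a =
  and (map (λ s → if isDes π s then aAt a s ≤⁻ aAt a (suc s)
                                else aAt a s ≤⁺ aAt a (suc s))
           (upTo n))

Ω′B : ∀ {n} → SignedPerm n → ℕ → ℕ
Ω′B {n} π k = length (filterᵇ (admissible k π) (allVecs (allT k) n))

Series : Set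
Series = ℕ → ℤ

_⊛_ : Series → Series → Series
(f ⊛ g) m = Data.List.foldr ℤ._+_ (+ 0)
              (map (λ i → f i ℤ.* g (m ∸ i)) (upTo (suc m)))
  where import Data.List

infixl 7 _⊛_

oneS : Series
oneS zero = + 1
oneS (suc _) = + 0

lin : ℤ → ℤ → Series
lin c₀ c₁ zero = c₀
lin c₀ c₁ (suc zero) = c₁
lin c₀ c₁ (suc (suc _)) = + 0

_^S_ : Series → ℕ → Series
f ^S zero = oneS
f ^S suc m = f ⊛ (f ^S m)

inv1-t : Series
inv1-t _ = + 1

inv1+t : Series
inv1+t zero = + 1
inv1+t (suc m) = ℤ.- inv1+t m

rhsSeries : ∀ {n} → SignedPerm n → Series
rhsSeries {n} π =
  (lin (+ 1) (+ 1) ^S n) ⊛ (inv1-t ^S suc n)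
  ⊛ ((lin (+ 0) (+ 2) ⊛ inv1+t) ^S vsig π)
  ⊛ ((lin (+ 0) (+ 4) ⊛ (inv1+t ^S 2)) ^S peB π)

{-# OPTIONS --safe #-}
-- Starting from a₀ = 0, each letter of an admissible word a₁ … aₙ ∈ T_kⁿ is constrained only by
-- its predecessor, so Ω′_B(π;k) is a transfer count. Measure elements of T_k by their distance r
-- below the top k; the sign ε is then the parity of r. If h(r) counts the admissible words of
-- length n starting just after an element at distance r, putting one more step in front turns h
-- into r ↦ Σ_{r′<r} h(r′) + [ε = +1 for an ascent, ε = −1 for a descent] h(r). With
-- E(t) = Σ h(2j) tʲ and O(t) = Σ h(2j − 1) tʲ we have Ω′_B(π;k) = [tᵏ] E, and the step reads
-- E′ = (E + O)/(1 − t), O′ = tE′ for an ascent and E′ = t(E + O)/(1 − t) + O, O′ = E′ for a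
-- descent. By induction O = tE or O = E according as the descent word starts with an ascent or a
-- descent, and E = (1 + t)ⁿ/(1 − t)ⁿ⁺¹ · (2t/(1 + t))^[it starts with a descent] · (4t/(1 + t)²)^#peaks;
-- the four cases of the induction step only use (1 + t) · 1/(1 + t) = 1 and 1/(1 − t) = 1 + t/(1 − t).
-- As the values of π are distinct, the peaks of its descent word are the peaks of π.
module Submission where

open import Defs

module Completions where

  open import Data.Bool.Base using (Bool; true; false; if_then_else_; not; _∧_; _xor_)
  open import Data.Nat.Base using (ℕ; zero; suc; _+_; _*_; _∸_; _≤_; s≤s)
  import Data.Nat.Properties as ℕ
  open import Function.Base using (_∘_)
  open import Relation.Binary.PropositionalEquality using (_≡_; refl; cong; trans)

  indicator : Bool → ℕ
  indicator b = if b then 1 else 0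

  isEven : ℕ → Bool
  isEven zero          = true
  isEven (suc zero)    = false
  isEven (suc (suc n)) = isEven n

  double : ℕ → ℕ
  double zero    = zero
  double (suc n) = suc (suc (double n))

  2*≡double : ∀ k → 2 * k ≡ double k
  2*≡double zero    = refl
  2*≡double (suc k) = cong suc (trans (ℕ.+-suc k (k + 0)) (cong suc (2*≡double k)))

  isEven-double : ∀ j → isEven (double j) ≡ true
  isEven-double zero    = refl
  isEven-double (suc j) = isEven-double j

  isEven-suc-double : ∀ j → isEven (suc (double j)) ≡ false
  isEven-suc-double zero    = refl
  isEven-suc-double (suc j) = isEven-suc-double j

  isEven-double∸ : ∀ k b → b ≤ double k → isEven (double k ∸ b) ≡ isEven b
  isEven-double∸ k       zero          _             = isEven-double k
  isEven-double∸ (suc k) (suc zero)    _             = isEven-suc-double k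
  isEven-double∸ (suc k) (suc (suc b)) (s≤s (s≤s p)) = isEven-double∸ k b p

  isEven-2*∸ : ∀ k b → b ≤ 2 * k → isEven (2 * k ∸ b) ≡ isEven b
  isEven-2*∸ k b rewrite 2*≡double k = isEven-double∸ k b

  sumBelow : (ℕ → ℕ) → ℕ → ℕ
  sumBelow h zero    = 0
  sumBelow h (suc r) = sumBelow h r + h r

  extend : Bool → (ℕ → ℕ) → ℕ → ℕ
  extend d h r = sumBelow h r + (if d xor isEven r then h r else 0)

  completions : (ℕ → Bool) → ℕ → ℕ → ℕ
  completions D zero    r = 1
  completions D (suc n) r = extend (D 0) (completions (D ∘ suc) n) r

  startsWithDescent : (ℕ → Bool) → ℕ → Bool
  startsWithDescent D zero    = false
  startsWithDescent D (suc n) = D 0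

  peaks : (ℕ → Bool) → ℕ → ℕ
  peaks D zero    = 0
  peaks D (suc n) = indicator (not (D 0) ∧ startsWithDescent (D ∘ suc) n) + peaks (D ∘ suc) n

module PowerSeries where

  open import Algebra.Bundles using (CommutativeSemiring)
  import Algebra.Construct.Pointwise as Pointwise
  open import Algebra.Structures.Biased using (isCommutativeSemiringˡ; IsCommutativeMonoidˡ)
  open import Data.Integer.Base using (ℤ; +_; _+_; _*_; -_)
  import Data.Integer.Properties as ℤ
  open import Data.Integer.Tactic.RingSolver using (solve-∀)
  open import Data.List.Base using (foldr; applyUpTo)
  open import Data.List.Properties using (map-applyUpTo)
  open import Data.Nat.Base using (ℕ; zero; suc; _∸_)
  open import Function.Base using (_∘_; const)
  open import Level using (0ℓ)
  open import Relation.Binary.PropositionalEquality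

  infixl 6 _⊕_

  _⊕_ : Series → Series → Series
  (f ⊕ g) m = f m + g m

  zeroS : Series
  zeroS = const (+ 0)

  _·_ : ℤ → Series → Series
  (c · f) m = c * f m

  tail : Series → Series
  tail f m = f (suc m)

  -- The Cauchy product by recursion on the first factor, in which form its laws go by induction.
  cauchy : Series → Series → Series
  cauchy f g zero    = f 0 * g 0
  cauchy f g (suc m) = f 0 * g (suc m) + cauchy (tail f) g m

  ⊛≗cauchy : ∀ f g → f ⊛ g ≗ cauchy f g
  ⊛≗cauchy f g m =
    trans (cong (foldr _+_ (+ 0)) (map-applyUpTo (λ i → i) (λ i → f i * g (m ∸ i)) (suc m)))
          (sum≡cauchy f m)
    where
    sum≡cauchy : ∀ f m → foldr _+_ (+ 0) (applyUpTo (λ i → f i * g (m ∸ i)) (suc m)) ≡ cauchy f g m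
    sum≡cauchy f zero    = ℤ.+-identityʳ (f 0 * g 0)
    sum≡cauchy f (suc m) = cong (_+_ (f 0 * g (suc m))) (sum≡cauchy (tail f) m)

  cauchy-cong : ∀ {f f′ g g′} → f ≗ f′ → g ≗ g′ → cauchy f g ≗ cauchy f′ g′
  cauchy-cong f≗ g≗ zero    = cong₂ _*_ (f≗ 0) (g≗ 0)
  cauchy-cong f≗ g≗ (suc m) = cong₂ _+_ (cong₂ _*_ (f≗ 0) (g≗ (suc m))) (cauchy-cong (f≗ ∘ suc) g≗ m)

  cauchy-zeroˡ : ∀ g → cauchy zeroS g ≗ zeroS
  cauchy-zeroˡ g zero    = refl
  cauchy-zeroˡ g (suc m) = cong (_+_ (+ 0)) (cauchy-zeroˡ g m)

  cauchy-identityˡ : ∀ g → cauchy oneS g ≗ g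
  cauchy-identityˡ g zero    = ℤ.*-identityˡ (g 0)
  cauchy-identityˡ g (suc m) = begin
    + 1 * g (suc m) + cauchy zeroS g m ≡⟨ cong₂ _+_ (ℤ.*-identityˡ (g (suc m))) (cauchy-zeroˡ g m) ⟩
    g (suc m) + + 0                    ≡⟨ ℤ.+-identityʳ (g (suc m)) ⟩
    g (suc m)                          ∎
    where open ≡-Reasoning

  cauchy-distribʳ : ∀ f f′ g → cauchy (f ⊕ f′) g ≗ cauchy f g ⊕ cauchy f′ g
  cauchy-distribʳ f f′ g zero    = ℤ.*-distribʳ-+ (g 0) (f 0) (f′ 0)
  cauchy-distribʳ f f′ g (suc m) =
    trans (cong (_+_ ((f 0 + f′ 0) * g (suc m))) (cauchy-distribʳ (tail f) (tail f′) g m))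
          (regroup (f 0) (f′ 0) (g (suc m)) (cauchy (tail f) g m) (cauchy (tail f′) g m))
    where
    regroup : ∀ a b c x y → (a + b) * c + (x + y) ≡ (a * c + x) + (b * c + y)
    regroup = solve-∀

  cauchy-scaleˡ : ∀ c f g → cauchy (c · f) g ≗ c · cauchy f g
  cauchy-scaleˡ c f g zero    = ℤ.*-assoc c (f 0) (g 0)
  cauchy-scaleˡ c f g (suc m) =
    trans (cong (_+_ (c * f 0 * g (suc m))) (cauchy-scaleˡ c (tail f) g m))
          (factor c (f 0) (g (suc m)) (cauchy (tail f) g m))
    where
    factor : ∀ c a b x → c * a * b + c * x ≡ c * (a * b + x)
    factor = solve-∀

  cauchy-sucʳ : ∀ f g m → cauchy f g (suc m) ≡ cauchy f (tail g) m + f (suc m) * g 0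
  cauchy-sucʳ f g zero    = refl
  cauchy-sucʳ f g (suc m) =
    trans (cong (_+_ (f 0 * g (suc (suc m)))) (cauchy-sucʳ (tail f) g m))
          (sym (ℤ.+-assoc (f 0 * g (suc (suc m))) (cauchy (tail f) (tail g) m) (f (suc (suc m)) * g 0)))

  cauchy-comm : ∀ f g → cauchy f g ≗ cauchy g f
  cauchy-comm f g zero    = ℤ.*-comm (f 0) (g 0)
  cauchy-comm f g (suc m) =
    trans (cong (_+_ (f 0 * g (suc m))) (cauchy-comm (tail f) g m))
          (trans (swap (f 0) (g (suc m)) (cauchy g (tail f) m)) (sym (cauchy-sucʳ g f m)))
    where
    swap : ∀ a b x → a * b + x ≡ x + b * a
    swap = solve-∀

  cauchy-assoc : ∀ f g h → cauchy (cauchy f g) h ≗ cauchy f (cauchy g h)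
  cauchy-assoc f g h zero    = ℤ.*-assoc (f 0) (g 0) (h 0)
  cauchy-assoc f g h (suc m) =
    trans (cong (_+_ (f 0 * g 0 * h (suc m)))
            (trans (cauchy-distribʳ (f 0 · tail g) (cauchy (tail f) g) h m)
                   (cong₂ _+_ (cauchy-scaleˡ (f 0) (tail g) h m) (cauchy-assoc (tail f) g h m))))
          (regroup (f 0) (g 0) (h (suc m)) (cauchy (tail g) h m) (cauchy (tail f) (cauchy g h) m))
    where
    regroup : ∀ a b c x y → a * b * c + (a * x + y) ≡ a * (b * c + x) + y
    regroup = solve-∀

  ⊛-cong : ∀ {f f′ g g′} → f ≗ f′ → g ≗ g′ → f ⊛ g ≗ f′ ⊛ g′
  ⊛-cong {f} {f′} {g} {g′} f≗ g≗ m =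
    trans (⊛≗cauchy f g m) (trans (cauchy-cong f≗ g≗ m) (sym (⊛≗cauchy f′ g′ m)))

  ⊛-comm : ∀ f g → f ⊛ g ≗ g ⊛ f
  ⊛-comm f g m = trans (⊛≗cauchy f g m) (trans (cauchy-comm f g m) (sym (⊛≗cauchy g f m)))

  ⊛-assoc : ∀ f g h → (f ⊛ g) ⊛ h ≗ f ⊛ (g ⊛ h)
  ⊛-assoc f g h m = begin
    ((f ⊛ g) ⊛ h) m           ≡⟨ ⊛≗cauchy (f ⊛ g) h m ⟩
    cauchy (f ⊛ g) h m        ≡⟨ cauchy-cong (⊛≗cauchy f g) (λ _ → refl) m ⟩
    cauchy (cauchy f g) h m   ≡⟨ cauchy-assoc f g h m ⟩
    cauchy f (cauchy g h) m   ≡⟨ cauchy-cong (λ _ → refl) (λ i → sym (⊛≗cauchy g h i)) m ⟩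
    cauchy f (g ⊛ h) m        ≡⟨ ⊛≗cauchy f (g ⊛ h) m ⟨
    (f ⊛ (g ⊛ h)) m           ∎
    where open ≡-Reasoning

  ⊛-identityˡ : ∀ g → oneS ⊛ g ≗ g
  ⊛-identityˡ g m = trans (⊛≗cauchy oneS g m) (cauchy-identityˡ g m)

  ⊛-zeroˡ : ∀ g → zeroS ⊛ g ≗ zeroS
  ⊛-zeroˡ g m = trans (⊛≗cauchy zeroS g m) (cauchy-zeroˡ g m)

  ⊛-distribʳ : ∀ g f f′ → (f ⊕ f′) ⊛ g ≗ (f ⊛ g) ⊕ (f′ ⊛ g)
  ⊛-distribʳ g f f′ m =
    trans (⊛≗cauchy (f ⊕ f′) g m)
          (trans (cauchy-distribʳ f f′ g m) (sym (cong₂ _+_ (⊛≗cauchy f g m) (⊛≗cauchy f′ g m))))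

  seriesSemiring : CommutativeSemiring 0ℓ 0ℓ
  seriesSemiring = record
    { Carrier = Series ; _≈_ = _≗_ ; _+_ = _⊕_ ; _*_ = _⊛_ ; 0# = zeroS ; 1# = oneS
    ; isCommutativeSemiring = isCommutativeSemiringˡ record
      { +-isCommutativeMonoid = Pointwise.isCommutativeMonoid ℕ ℤ.+-0-isCommutativeMonoid
      ; *-isCommutativeMonoid = IsCommutativeMonoidˡ.isCommutativeMonoid record
        { isSemigroup = record
          { isMagma = record { isEquivalence = Pointwise.isEquivalence ℕ isEquivalence ; ∙-cong = ⊛-cong }
          ; assoc   = ⊛-assoc
          }
        ; identityˡ = ⊛-identityˡ
        ; comm      = ⊛-comm
        }
      ; distribʳ = ⊛-distribʳ
      ; zeroˡ    = ⊛-zeroˡ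
      }
    }

  -- The unchanged factor is explicit: it cannot be recovered from a goal in which _⊛_ has unfolded.
  ⊛-congˡ : ∀ f {g g′} → g ≗ g′ → f ⊛ g ≗ f ⊛ g′
  ⊛-congˡ f g≗ = ⊛-cong {f} {f} (λ _ → refl) g≗

  ⊛-congʳ : ∀ g {f f′} → f ≗ f′ → f ⊛ g ≗ f′ ⊛ g
  ⊛-congʳ g f≗ = ⊛-cong {g = g} {g} f≗ (λ _ → refl)

  ⊕-cong : ∀ {f f′ g g′} → f ≗ f′ → g ≗ g′ → f ⊕ g ≗ f′ ⊕ g′
  ⊕-cong f≗ g≗ m = cong₂ _+_ (f≗ m) (g≗ m)

  ⊕-congˡ : ∀ f {g g′} → g ≗ g′ → f ⊕ g ≗ f ⊕ g′
  ⊕-congˡ f g≗ m = cong (_+_ (f m)) (g≗ m)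

  ⊕-congʳ : ∀ g {f f′} → f ≗ f′ → f ⊕ g ≗ f′ ⊕ g
  ⊕-congʳ g f≗ m = cong (_+ g m) (f≗ m)

  t : Series
  t = lin (+ 0) (+ 1)

  1+t : Series
  1+t = lin (+ 1) (+ 1)

  shift : Series → Series
  shift f zero    = + 0
  shift f (suc m) = f m

  partialSums : Series → Series
  partialSums f zero    = f 0
  partialSums f (suc m) = partialSums f m + f (suc m)

  tail-lin1 : ∀ c → tail (lin c (+ 1)) ≗ oneS
  tail-lin1 c zero    = refl
  tail-lin1 c (suc _) = refl

  t⊛≗shift : ∀ f → t ⊛ f ≗ shift f
  t⊛≗shift f zero    = ⊛≗cauchy t f 0
  t⊛≗shift f (suc m) = begin
    (t ⊛ f) (suc m)                       ≡⟨ ⊛≗cauchy t f (suc m) ⟩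
    + 0 * f (suc m) + cauchy (tail t) f m ≡⟨ cong (_+_ (+ 0)) (cauchy-cong (tail-lin1 (+ 0)) (λ _ → refl) m) ⟩
    + 0 + cauchy oneS f m                 ≡⟨ cong (_+_ (+ 0)) (cauchy-identityˡ f m) ⟩
    + 0 + f m                             ≡⟨ ℤ.+-identityˡ (f m) ⟩
    f m                                   ∎
    where open ≡-Reasoning

  inv1-t⊛≗partialSums : ∀ f → inv1-t ⊛ f ≗ partialSums f
  inv1-t⊛≗partialSums f m = trans (⊛≗cauchy inv1-t f m) (cauchy-partialSums m)
    where
    cauchy-partialSums : ∀ m → cauchy inv1-t f m ≡ partialSums f m
    cauchy-partialSums zero    = ℤ.*-identityˡ (f 0)
    cauchy-partialSums (suc m) =
      trans (cong₂ _+_ (ℤ.*-identityˡ (f (suc m))) (cauchy-partialSums m))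
            (ℤ.+-comm (f (suc m)) (partialSums f m))

  t⊛inv1-t⊛≗shift∘partialSums : ∀ f → t ⊛ (inv1-t ⊛ f) ≗ shift (partialSums f)
  t⊛inv1-t⊛≗shift∘partialSums f m =
    trans (⊛-congˡ t (inv1-t⊛≗partialSums f) m) (t⊛≗shift (partialSums f) m)

  1+t⊛inv1+t : 1+t ⊛ inv1+t ≗ oneS
  1+t⊛inv1+t zero    = refl
  1+t⊛inv1+t (suc m) = begin
    (1+t ⊛ inv1+t) (suc m)                            ≡⟨ ⊛≗cauchy 1+t inv1+t (suc m) ⟩
    + 1 * inv1+t (suc m) + cauchy (tail 1+t) inv1+t m ≡⟨ cong₂ _+_ (ℤ.*-identityˡ (inv1+t (suc m)))
                                                                   (cauchy-cong (tail-lin1 (+ 1)) (λ _ → refl) m) ⟩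
    inv1+t (suc m) + cauchy oneS inv1+t m             ≡⟨ cong (_+_ (inv1+t (suc m))) (cauchy-identityˡ inv1+t m) ⟩
    - inv1+t m + inv1+t m                             ≡⟨ ℤ.+-inverseˡ (inv1+t m) ⟩
    + 0                                               ∎
    where open ≡-Reasoning

  inv1-t-recurrence : inv1-t ≗ oneS ⊕ t ⊛ inv1-t
  inv1-t-recurrence zero    = sym (cong (_+_ (+ 1)) (t⊛≗shift inv1-t 0))
  inv1-t-recurrence (suc m) = sym (cong (_+_ (+ 0)) (t⊛≗shift inv1-t (suc m)))

module ClosedForm where

  open PowerSeries
  open Completions using (indicator)
  open import Algebra.Bundles using (CommutativeSemiring)
  open import Algebra.Solver.Ring.NaturalCoefficients.Default seriesSemiring
    using (solve; _:=_; _:+_; _:*_; con)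
  open import Data.Bool.Base using (Bool; true; false; not; _∧_)
  open import Data.Integer.Base using (+_)
  open import Data.Nat.Base using (ℕ; zero; suc; _+_)
  open import Relation.Binary.PropositionalEquality using (_≗_; refl)
  import Relation.Binary.PropositionalEquality as Eq
  open import Relation.Binary.Reasoning.Setoid (CommutativeSemiring.setoid seriesSemiring)

  signFactor : Series
  signFactor = lin (+ 0) (+ 2) ⊛ inv1+t

  peakFactor : Series
  peakFactor = lin (+ 0) (+ 4) ⊛ (inv1+t ^S 2)

  closedForm : ℕ → ℕ → ℕ → Series
  closedForm n s p = (1+t ^S n) ⊛ (inv1-t ^S suc n) ⊛ (signFactor ^S s) ⊛ (peakFactor ^S p)

  1+t-unfold : 1+t ≗ oneS ⊕ t
  1+t-unfold zero          = refl
  1+t-unfold (suc zero)    = refl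
  1+t-unfold (suc (suc _)) = refl

  signFactor-unfold : signFactor ≗ (t ⊕ t) ⊛ inv1+t
  signFactor-unfold = ⊛-congʳ inv1+t 2t
    where
    2t : lin (+ 0) (+ 2) ≗ t ⊕ t
    2t zero          = refl
    2t (suc zero)    = refl
    2t (suc (suc _)) = refl

  peakFactor-unfold : peakFactor ≗ (t ⊕ t ⊕ t ⊕ t) ⊛ (inv1+t ^S 2)
  peakFactor-unfold = ⊛-congʳ (inv1+t ^S 2) 4t
    where
    4t : lin (+ 0) (+ 4) ≗ t ⊕ t ⊕ t ⊕ t
    4t zero          = refl
    4t (suc zero)    = refl
    4t (suc (suc _)) = refl

  signFactor⊛1+t : signFactor ⊛ 1+t ≗ t ⊕ t
  signFactor⊛1+t = begin
    signFactor ⊛ 1+t           ≈⟨ ⊛-congʳ 1+t signFactor-unfold ⟩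
    (t ⊕ t) ⊛ inv1+t ⊛ 1+t     ≈⟨ solve 3 (λ t i a → (t :+ t) :* i :* a := (t :+ t) :* (a :* i))
                                    (λ _ → refl) t inv1+t 1+t ⟩
    (t ⊕ t) ⊛ (1+t ⊛ inv1+t)   ≈⟨ ⊛-congˡ (t ⊕ t) 1+t⊛inv1+t ⟩
    (t ⊕ t) ⊛ oneS             ≈⟨ solve 1 (λ t → (t :+ t) :* con 1 := t :+ t) (λ _ → refl) t ⟩
    t ⊕ t                      ∎

  1+t⊛peakFactor : 1+t ⊛ peakFactor ≗ signFactor ⊕ signFactor
  1+t⊛peakFactor = begin
    1+t ⊛ peakFactor                            ≈⟨ ⊛-congˡ 1+t peakFactor-unfold ⟩
    1+t ⊛ ((t ⊕ t ⊕ t ⊕ t) ⊛ (inv1+t ^S 2))     ≈⟨ solve 3 (λ t i a → a :* ((t :+ t :+ t :+ t) :* (i :* (i :* con 1)))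
                                                               := (t :+ t :+ t :+ t) :* i :* (a :* i))
                                                     (λ _ → refl) t inv1+t 1+t ⟩
    (t ⊕ t ⊕ t ⊕ t) ⊛ inv1+t ⊛ (1+t ⊛ inv1+t)   ≈⟨ ⊛-congˡ ((t ⊕ t ⊕ t ⊕ t) ⊛ inv1+t) 1+t⊛inv1+t ⟩
    (t ⊕ t ⊕ t ⊕ t) ⊛ inv1+t ⊛ oneS             ≈⟨ solve 2 (λ t i → (t :+ t :+ t :+ t) :* i :* con 1
                                                               := (t :+ t) :* i :+ (t :+ t) :* i)
                                                     (λ _ → refl) t inv1+t ⟩
    (t ⊕ t) ⊛ inv1+t ⊕ (t ⊕ t) ⊛ inv1+t         ≈⟨ ⊕-cong signFactor-unfold signFactor-unfold ⟨
    signFactor ⊕ signFactor                     ∎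

  1+t⊛inv1-t : 1+t ⊛ inv1-t ≗ oneS ⊕ (t ⊕ t) ⊛ inv1-t
  1+t⊛inv1-t = begin
    1+t ⊛ inv1-t                     ≈⟨ ⊛-congʳ inv1-t 1+t-unfold ⟩
    (oneS ⊕ t) ⊛ inv1-t              ≈⟨ solve 2 (λ t b → (con 1 :+ t) :* b := b :+ t :* b) (λ _ → refl) t inv1-t ⟩
    inv1-t ⊕ t ⊛ inv1-t              ≈⟨ ⊕-congʳ (t ⊛ inv1-t) inv1-t-recurrence ⟩
    oneS ⊕ t ⊛ inv1-t ⊕ t ⊛ inv1-t   ≈⟨ solve 2 (λ t b → con 1 :+ t :* b :+ t :* b := con 1 :+ (t :+ t) :* b)
                                          (λ _ → refl) t inv1-t ⟩
    oneS ⊕ (t ⊕ t) ⊛ inv1-t          ∎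

  closedForm-zero : closedForm 0 0 0 ≗ inv1-t
  closedForm-zero = solve 1 (λ b → con 1 :* (b :* con 1) :* con 1 :* con 1 := b) (λ _ → refl) inv1-t

  closedForm-suc : ∀ n s p → closedForm (suc n) s p ≗ 1+t ⊛ inv1-t ⊛ closedForm n s p
  closedForm-suc n s p =
    solve 6 (λ a b aⁿ bⁿ cˢ dᵖ → a :* aⁿ :* (b :* bⁿ) :* cˢ :* dᵖ := a :* b :* (aⁿ :* bⁿ :* cˢ :* dᵖ))
      (λ _ → refl) 1+t inv1-t (1+t ^S n) (inv1-t ^S suc n) (signFactor ^S s) (peakFactor ^S p)

  closedForm-sign : ∀ n p → closedForm n 1 p ≗ signFactor ⊛ closedForm n 0 p
  closedForm-sign n p =
    solve 4 (λ c aⁿ bⁿ dᵖ → aⁿ :* bⁿ :* (c :* con 1) :* dᵖ := c :* (aⁿ :* bⁿ :* con 1 :* dᵖ))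
      (λ _ → refl) signFactor (1+t ^S n) (inv1-t ^S suc n) (peakFactor ^S p)

  closedForm-peak : ∀ n s p → closedForm n s (suc p) ≗ peakFactor ⊛ closedForm n s p
  closedForm-peak n s p =
    solve 5 (λ d aⁿ bⁿ cˢ dᵖ → aⁿ :* bⁿ :* cˢ :* (d :* dᵖ) := d :* (aⁿ :* bⁿ :* cˢ :* dᵖ))
      (λ _ → refl) peakFactor (1+t ^S n) (inv1-t ^S suc n) (signFactor ^S s) (peakFactor ^S p)

  OddRelation : Bool → Series → Series → Set
  OddRelation true  o e = o ≗ e
  OddRelation false o e = o ≗ t ⊛ e

  nextEven : Bool → Series → Series → Series
  nextEven false e o = inv1-t ⊛ (e ⊕ o)
  nextEven true  e o = t ⊛ (inv1-t ⊛ (e ⊕ o)) ⊕ o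

  module _ (n p : ℕ) {e o : Series} where

    ascent-before-ascent : e ≗ closedForm n 0 p → o ≗ t ⊛ e → nextEven false e o ≗ closedForm (suc n) 0 p
    ascent-before-ascent e≗ o≗ = begin
      inv1-t ⊛ (e ⊕ o)                  ≈⟨ ⊛-congˡ inv1-t (⊕-congˡ e o≗) ⟩
      inv1-t ⊛ (e ⊕ t ⊛ e)              ≈⟨ solve 3 (λ b t e → b :* (e :+ t :* e) := (con 1 :+ t) :* b :* e)
                                             (λ _ → refl) inv1-t t e ⟩
      (oneS ⊕ t) ⊛ inv1-t ⊛ e           ≈⟨ ⊛-congʳ e (⊛-congʳ inv1-t 1+t-unfold) ⟨
      1+t ⊛ inv1-t ⊛ e                  ≈⟨ ⊛-congˡ (1+t ⊛ inv1-t) e≗ ⟩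
      1+t ⊛ inv1-t ⊛ closedForm n 0 p   ≈⟨ closedForm-suc n 0 p ⟨
      closedForm (suc n) 0 p            ∎

    ascent-before-descent : e ≗ closedForm n 1 p → o ≗ e → nextEven false e o ≗ closedForm (suc n) 0 (suc p)
    ascent-before-descent e≗ o≗ = begin
      inv1-t ⊛ (e ⊕ o)                          ≈⟨ ⊛-congˡ inv1-t (⊕-congˡ e o≗) ⟩
      inv1-t ⊛ (e ⊕ e)                          ≈⟨ ⊛-congˡ inv1-t (⊕-cong e≗c⊛q e≗c⊛q) ⟩
      inv1-t ⊛ (signFactor ⊛ q ⊕ signFactor ⊛ q) ≈⟨ solve 3 (λ b c q → b :* (c :* q :+ c :* q) := b :* ((c :+ c) :* q))
                                                     (λ _ → refl) inv1-t signFactor q ⟩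
      inv1-t ⊛ ((signFactor ⊕ signFactor) ⊛ q)  ≈⟨ ⊛-congˡ inv1-t (⊛-congʳ q 1+t⊛peakFactor) ⟨
      inv1-t ⊛ (1+t ⊛ peakFactor ⊛ q)           ≈⟨ solve 4 (λ b a d q → b :* (a :* d :* q) := a :* b :* (d :* q))
                                                     (λ _ → refl) inv1-t 1+t peakFactor q ⟩
      1+t ⊛ inv1-t ⊛ (peakFactor ⊛ q)           ≈⟨ ⊛-congˡ (1+t ⊛ inv1-t) (closedForm-peak n 0 p) ⟨
      1+t ⊛ inv1-t ⊛ closedForm n 0 (suc p)     ≈⟨ closedForm-suc n 0 (suc p) ⟨
      closedForm (suc n) 0 (suc p)              ∎
      where
      q = closedForm n 0 p
      e≗c⊛q : e ≗ signFactor ⊛ q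
      e≗c⊛q m = Eq.trans (e≗ m) (closedForm-sign n p m)

    descent-before-ascent : e ≗ closedForm n 0 p → o ≗ t ⊛ e → nextEven true e o ≗ closedForm (suc n) 1 p
    descent-before-ascent e≗ o≗ = begin
      t ⊛ (inv1-t ⊛ (e ⊕ o)) ⊕ o              ≈⟨ ⊕-cong (⊛-congˡ t (⊛-congˡ inv1-t (⊕-congˡ e o≗))) o≗ ⟩
      t ⊛ (inv1-t ⊛ (e ⊕ t ⊛ e)) ⊕ t ⊛ e      ≈⟨ solve 3 (λ b t e → t :* (b :* (e :+ t :* e)) :+ t :* e
                                                             := t :* (b :+ (con 1 :+ t :* b)) :* e)
                                                   (λ _ → refl) inv1-t t e ⟩
      t ⊛ (inv1-t ⊕ (oneS ⊕ t ⊛ inv1-t)) ⊛ e  ≈⟨ ⊛-congʳ e (⊛-congˡ t (⊕-congˡ inv1-t inv1-t-recurrence)) ⟨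
      t ⊛ (inv1-t ⊕ inv1-t) ⊛ e               ≈⟨ solve 3 (λ b t e → t :* (b :+ b) :* e := (t :+ t) :* b :* e)
                                                   (λ _ → refl) inv1-t t e ⟩
      (t ⊕ t) ⊛ inv1-t ⊛ e                    ≈⟨ ⊛-congʳ e (⊛-congʳ inv1-t signFactor⊛1+t) ⟨
      signFactor ⊛ 1+t ⊛ inv1-t ⊛ e           ≈⟨ solve 4 (λ c a b e → c :* a :* b :* e := a :* b :* (c :* e))
                                                   (λ _ → refl) signFactor 1+t inv1-t e ⟩
      1+t ⊛ inv1-t ⊛ (signFactor ⊛ e)         ≈⟨ ⊛-congˡ (1+t ⊛ inv1-t) (⊛-congˡ signFactor e≗) ⟩
      1+t ⊛ inv1-t ⊛ (signFactor ⊛ closedForm n 0 p) ≈⟨ ⊛-congˡ (1+t ⊛ inv1-t) (closedForm-sign n p) ⟨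
      1+t ⊛ inv1-t ⊛ closedForm n 1 p         ≈⟨ closedForm-suc n 1 p ⟨
      closedForm (suc n) 1 p                  ∎

    descent-before-descent : e ≗ closedForm n 1 p → o ≗ e → nextEven true e o ≗ closedForm (suc n) 1 p
    descent-before-descent e≗ o≗ = begin
      t ⊛ (inv1-t ⊛ (e ⊕ o)) ⊕ o        ≈⟨ ⊕-cong (⊛-congˡ t (⊛-congˡ inv1-t (⊕-congˡ e o≗))) o≗ ⟩
      t ⊛ (inv1-t ⊛ (e ⊕ e)) ⊕ e        ≈⟨ solve 3 (λ b t e → t :* (b :* (e :+ e)) :+ e
                                                       := (con 1 :+ (t :+ t) :* b) :* e)
                                             (λ _ → refl) inv1-t t e ⟩
      (oneS ⊕ (t ⊕ t) ⊛ inv1-t) ⊛ e     ≈⟨ ⊛-congʳ e 1+t⊛inv1-t ⟨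
      1+t ⊛ inv1-t ⊛ e                  ≈⟨ ⊛-congˡ (1+t ⊛ inv1-t) e≗ ⟩
      1+t ⊛ inv1-t ⊛ closedForm n 1 p   ≈⟨ closedForm-suc n 1 p ⟨
      closedForm (suc n) 1 p            ∎

  nextEven-closedForm : ∀ b c n p {e o} → e ≗ closedForm n (indicator c) p → OddRelation c o e →
                        nextEven b e o ≗ closedForm (suc n) (indicator b) (indicator (not b ∧ c) + p)
  nextEven-closedForm false false n p = ascent-before-ascent n p
  nextEven-closedForm false true  n p = ascent-before-descent n p
  nextEven-closedForm true  false n p = descent-before-ascent n p
  nextEven-closedForm true  true  n p = descent-before-descent n p

module GeneratingFunction where

  open PowerSeries
  open ClosedForm
  open Completions
  open import Data.Bool.Base using (true; false)
  open import Data.Integer.Base using (+_; _+_)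
  import Data.Integer.Properties as ℤ
  open import Data.Integer.Tactic.RingSolver using (solve-∀)
  open import Data.Nat.Base using (ℕ; zero; suc)
  import Data.Nat.Properties as ℕ
  open import Data.Product.Base using (_×_; _,_)
  open import Function.Base using (_∘_)
  open import Relation.Binary.PropositionalEquality

  evenPart : (ℕ → ℕ) → Series
  evenPart h j = + h (double j)

  oddPart : (ℕ → ℕ) → Series
  oddPart h zero    = + 0
  oddPart h (suc j) = + h (suc (double j))

  module _ (h : ℕ → ℕ) where
    private
      s = evenPart h ⊕ oddPart h

    sumBelow-suc-double : ∀ j → + sumBelow h (suc (double j)) ≡ partialSums s j
    sumBelow-suc-double zero    = ℤ.+-comm (+ 0) (+ h 0)
    sumBelow-suc-double (suc j) =
      trans (cong (λ z → z + + h (suc (double j)) + + h (double (suc j))) (sumBelow-suc-double j))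
            (regroup (partialSums s j) (+ h (suc (double j))) (+ h (double (suc j))))
      where
      regroup : ∀ x o e → x + o + e ≡ x + (e + o)
      regroup = solve-∀

    sumBelow-double : ∀ j → + sumBelow h (double j) ≡ shift (partialSums s) j + oddPart h j
    sumBelow-double zero    = refl
    sumBelow-double (suc j) = cong (_+ + h (suc (double j))) (sumBelow-suc-double j)

    extend-ascent-even : ∀ j → + extend false h (double j) ≡ partialSums s j
    extend-ascent-even j rewrite isEven-double j = sumBelow-suc-double j

    extend-ascent-odd : oddPart (extend false h) ≗ shift (partialSums s)
    extend-ascent-odd zero    = refl
    extend-ascent-odd (suc j) rewrite isEven-suc-double j =
      trans (cong +_ (ℕ.+-identityʳ _)) (sumBelow-suc-double j)

    extend-descent-even : ∀ j → + extend true h (double j) ≡ shift (partialSums s) j + oddPart h j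
    extend-descent-even j rewrite isEven-double j =
      trans (cong +_ (ℕ.+-identityʳ _)) (sumBelow-double j)

    extend-descent-odd : oddPart (extend true h) ≗ shift (partialSums s) ⊕ oddPart h
    extend-descent-odd zero    = refl
    extend-descent-odd (suc j) rewrite isEven-suc-double j =
      cong (_+ + h (suc (double j))) (sumBelow-suc-double j)

    evenPart-extend : ∀ d → evenPart (extend d h) ≗ nextEven d (evenPart h) (oddPart h)
    evenPart-extend false j = trans (extend-ascent-even j) (sym (inv1-t⊛≗partialSums s j))
    evenPart-extend true  j =
      trans (extend-descent-even j) (cong (_+ oddPart h j) (sym (t⊛inv1-t⊛≗shift∘partialSums s j)))

    oddRelation-extend : ∀ d → OddRelation d (oddPart (extend d h)) (evenPart (extend d h))
    oddRelation-extend false j =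
      trans (extend-ascent-odd j)
            (sym (trans (⊛-congˡ t extend-ascent-even j) (t⊛≗shift (partialSums s) j)))
    oddRelation-extend true  j = trans (extend-descent-odd j) (sym (extend-descent-even j))

  completions-closedForm : ∀ D n →
    evenPart (completions D n) ≗ closedForm n (indicator (startsWithDescent D n)) (peaks D n) ×
    OddRelation (startsWithDescent D n) (oddPart (completions D n)) (evenPart (completions D n))
  completions-closedForm D zero =
    (λ j → sym (closedForm-zero j)) , (λ j → trans (oddPart-one j) (sym (t⊛≗shift _ j)))
    where
    oddPart-one : oddPart (λ _ → 1) ≗ shift (evenPart (λ _ → 1))
    oddPart-one zero    = refl
    oddPart-one (suc j) = refl
  completions-closedForm D (suc n) with completions-closedForm (D ∘ suc) n
  ... | e≗ , o≗ =
    (λ j → trans (evenPart-extend h (D 0) j) (nextEven-closedForm (D 0) c n (peaks (D ∘ suc) n) e≗ o≗ j)) ,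
    oddRelation-extend h (D 0)
    where
    h = completions (D ∘ suc) n
    c = startsWithDescent (D ∘ suc) n

module FilterCounting where

  open Completions using (indicator)
  open import Data.Bool.Base using (Bool; true; false; if_then_else_; _∧_)
  import Data.Bool.Base as Bool
  open import Data.List.Base using (List; []; _∷_; map; filterᵇ; length; concatMap)
  open import Data.List.Properties using (filter-++; filter-≐; length-++)
  open import Data.Nat.Base using (_+_)
  open import Data.Nat.ListAction using (sum)
  open import Data.Product.Base using (_,_)
  open import Function.Base using (_∘_)
  open import Relation.Binary.PropositionalEquality
  open import Relation.Nullary.Decidable using (T?)

  filterᵇ-cong : ∀ {A : Set} {p q : A → Bool} → (∀ x → p x ≡ q x) → ∀ xs → filterᵇ p xs ≡ filterᵇ q xs
  filterᵇ-cong {p = p} {q} p≗q =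
    filter-≐ (T? ∘ p) (T? ∘ q) ((λ {x} → subst Bool.T (p≗q x)) , (λ {x} → subst Bool.T (sym (p≗q x))))

  length-filterᵇ-∷ : ∀ {A : Set} (p : A → Bool) x xs →
                     length (filterᵇ p (x ∷ xs)) ≡ indicator (p x) + length (filterᵇ p xs)
  length-filterᵇ-∷ p x xs with p x
  ... | true  = refl
  ... | false = refl

  length-filterᵇ-concatMap : ∀ {A B : Set} (p : B → Bool) (f : A → List B) xs →
                             length (filterᵇ p (concatMap f xs)) ≡ sum (map (λ x → length (filterᵇ p (f x))) xs)
  length-filterᵇ-concatMap p f []       = refl
  length-filterᵇ-concatMap p f (x ∷ xs) =
    trans (cong length (filter-++ (T? ∘ p) (f x) (concatMap f xs)))
          (trans (length-++ (filterᵇ p (f x)))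
                 (cong (length (filterᵇ p (f x)) +_) (length-filterᵇ-concatMap p f xs)))

  length-filterᵇ-map : ∀ {A B : Set} (p : B → Bool) (f : A → B) xs →
                       length (filterᵇ p (map f xs)) ≡ length (filterᵇ (p ∘ f) xs)
  length-filterᵇ-map p f []       = refl
  length-filterᵇ-map p f (x ∷ xs) =
    trans (length-filterᵇ-∷ p (f x) (map f xs))
          (trans (cong (indicator (p (f x)) +_) (length-filterᵇ-map p f xs))
                 (sym (length-filterᵇ-∷ (p ∘ f) x xs)))

  length-filterᵇ-∧ : ∀ {A : Set} c (q : A → Bool) xs →
                     length (filterᵇ (λ x → c ∧ q x) xs) ≡ (if c then length (filterᵇ q xs) else 0)
  length-filterᵇ-∧ true  q xs       = refl
  length-filterᵇ-∧ false q []       = refl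
  length-filterᵇ-∧ false q (x ∷ xs) = length-filterᵇ-∧ false q xs

module ChainCounting where

  open Completions
  open FilterCounting
  open import Data.Bool.Base using (Bool; true; false; if_then_else_; _∧_; _∨_; _xor_)
  open import Data.Bool.ListAction using (and)
  open import Data.Fin.Base using (Fin; zero; suc; toℕ; fromℕ<)
  import Data.Fin.Properties as Fin
  open import Data.List.Base using (_∷_; map; applyUpTo; upTo; filterᵇ; length; allFin; tabulate)
  open import Data.List.Properties using (map-cong; map-upTo; map-tabulate)
  open import Data.Nat.Base as ℕ using (ℕ; zero; suc; _+_; _*_; _∸_; _%_; _≤_; _<_; z≤n; s≤s)
  import Data.Nat.Properties as ℕ
  open import Data.Nat.ListAction using (sum)
  open import Data.Vec.Base using (Vec; []; _∷_; lookup)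
  open import Function.Base using (_∘_)
  open import Relation.Binary.PropositionalEquality
  open import Relation.Nullary using (¬_; does; yes; no; contradiction)

  step : ∀ {m} → Bool → Fin m → Fin m → Bool
  step d x y = if d then x ≤⁻ y else x ≤⁺ y

  isChain : ∀ {m n} → (ℕ → Bool) → Fin m → Vec (Fin m) n → Bool
  isChain D x []      = true
  isChain D x (y ∷ a) = step (D 0) x y ∧ isChain (D ∘ suc) y a

  -- The s-th letter of the word x a₁ … aₙ, and zero beyond its end (as for aAt).
  letter : ∀ {m n} → Fin (suc m) → Vec (Fin (suc m)) n → ℕ → Fin (suc m)
  letter x a       zero    = x
  letter x []      (suc s) = zero
  letter x (y ∷ a) (suc s) = letter y a s

  lookup≡letter : ∀ {m n} x (a : Vec (Fin (suc m)) n) j (j<n : j < n) →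
                  lookup a (fromℕ< j<n) ≡ letter x a (suc j)
  lookup≡letter x (y ∷ a) zero    _         = refl
  lookup≡letter x (y ∷ a) (suc j) (s≤s j<n) = lookup≡letter y a j j<n

  letter-beyond : ∀ {m n} x (a : Vec (Fin (suc m)) n) j → ¬ j < n → letter x a (suc j) ≡ zero
  letter-beyond x []      j       _   = refl
  letter-beyond x (y ∷ a) zero    j≮n = contradiction (s≤s z≤n) j≮n
  letter-beyond x (y ∷ a) (suc j) j≮n = letter-beyond y a j (j≮n ∘ s≤s)

  aAt≡letter : ∀ {m n} (a : Vec (Fin (suc m)) n) s → aAt a s ≡ letter zero a s
  aAt≡letter         a zero    = refl
  aAt≡letter {n = n} a (suc j) with j ℕ.<? n
  ... | yes j<n = lookup≡letter zero a j j<n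
  ... | no  j≮n = sym (letter-beyond zero a j j≮n)

  and-steps≡isChain : ∀ {m n} D x (a : Vec (Fin (suc m)) n) →
                      and (applyUpTo (λ s → step (D s) (letter x a s) (letter x a (suc s))) n) ≡ isChain D x a
  and-steps≡isChain D x []      = refl
  and-steps≡isChain D x (y ∷ a) = cong (step (D 0) x y ∧_) (and-steps≡isChain (D ∘ suc) y a)

  admissible≡isChain : ∀ {n} k (π : SignedPerm n) (a : Vec (T k) n) → admissible k π a ≡ isChain (isDes π) zero a
  admissible≡isChain {n} k π a = begin
    admissible k π a
      ≡⟨ cong and (map-cong (λ s → cong₂ (step (D s)) (aAt≡letter a s) (aAt≡letter a (suc s))) (upTo n)) ⟩
    and (map steps (upTo n))
      ≡⟨ cong and (map-upTo steps n) ⟩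
    and (applyUpTo steps n)
      ≡⟨ and-steps≡isChain D zero a ⟩
    isChain D zero a
      ∎
    where
    open ≡-Reasoning
    D = isDes π
    steps = λ s → step (D s) (letter zero a s) (letter zero a (suc s))

  chainsFrom : ∀ k → (ℕ → Bool) → ℕ → T k → ℕ
  chainsFrom k D n x = length (filterᵇ (isChain D x) (allVecs (allT k) n))

  chainsFrom-suc : ∀ k D n (x : T k) →
    chainsFrom k D (suc n) x ≡ sum (map (λ y → if step (D 0) x y then chainsFrom k (D ∘ suc) n y else 0) (allT k))
  chainsFrom-suc k D n x =
    trans (length-filterᵇ-concatMap (isChain D x) (λ y → map (y ∷_) words) (allT k))
          (cong sum (map-cong prepend (allT k)))
    where
    words = allVecs (allT k) n
    prepend : ∀ y → length (filterᵇ (isChain D x) (map (y ∷_) words))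
                  ≡ (if step (D 0) x y then chainsFrom k (D ∘ suc) n y else 0)
    prepend y = trans (length-filterᵇ-map (isChain D x) (y ∷_) words)
                      (length-filterᵇ-∧ (step (D 0) x y) (isChain (D ∘ suc) y) words)

  stepℕ : Bool → ℕ → ℕ → Bool
  stepℕ stay b c = does (b ℕ.<? c) ∨ (does (b ℕ.≟ c) ∧ stay)

  step≡stepℕ : ∀ {m} d (x y : Fin m) → step d x y ≡ stepℕ (d xor εpos x) (toℕ x) (toℕ y)
  step≡stepℕ true  x y = refl
  step≡stepℕ false x y = refl

  εpos≡isEven : ∀ {m} (x : Fin m) → εpos x ≡ isEven (toℕ x)
  εpos≡isEven x = parity (toℕ x)
    where
    parity : ∀ b → does (b % 2 ℕ.≟ 0) ≡ isEven b
    parity zero          = refl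
    parity (suc zero)    = refl
    parity (suc (suc b)) = parity b

  map-allFin : ∀ N (u : ℕ → ℕ) → map (u ∘ toℕ) (allFin N) ≡ applyUpTo u N
  map-allFin N u = trans (map-tabulate (λ i → i) (u ∘ toℕ)) (tabulate-toℕ N u)
    where
    tabulate-toℕ : ∀ N (u : ℕ → ℕ) → tabulate {n = N} (u ∘ toℕ) ≡ applyUpTo u N
    tabulate-toℕ zero    u = refl
    tabulate-toℕ (suc N) u = cong (u 0 ∷_) (tabulate-toℕ N (u ∘ suc))

  sum-reversed : ∀ K (h : ℕ → ℕ) → sum (applyUpTo (λ c → h (K ∸ suc c)) K) ≡ sumBelow h K
  sum-reversed zero    h = refl
  sum-reversed (suc K) h = trans (cong (h K +_) (sum-reversed K h)) (ℕ.+-comm (h K) (sumBelow h K))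

  sum-stepℕ : ∀ stay K b (h : ℕ → ℕ) → b ≤ K →
              sum (applyUpTo (λ c → if stepℕ stay b c then h (K ∸ c) else 0) (suc K))
                ≡ sumBelow h (K ∸ b) + (if stay then h (K ∸ b) else 0)
  sum-stepℕ stay K       zero    h _         =
    trans (cong ((if stay then h K else 0) +_) (sum-reversed K h)) (ℕ.+-comm _ (sumBelow h K))
  sum-stepℕ stay (suc K) (suc b) h (s≤s b≤K) = sum-stepℕ stay K b h b≤K

  chainsFrom≡completions : ∀ k D n (x : T k) → chainsFrom k D n x ≡ completions D n (2 * k ∸ toℕ x)
  chainsFrom≡completions k D zero    x = refl
  chainsFrom≡completions k D (suc n) x = begin
    chainsFrom k D (suc n) x
      ≡⟨ chainsFrom-suc k D n x ⟩
    sum (map (λ y → if step (D 0) x y then chainsFrom k (D ∘ suc) n y else 0) (allT k))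
      ≡⟨ cong sum (map-cong (λ y → cong₂ (λ c z → if c then z else 0)
                                         (step≡stepℕ (D 0) x y) (chainsFrom≡completions k (D ∘ suc) n y))
                            (allT k)) ⟩
    sum (map (u ∘ toℕ) (allT k))
      ≡⟨ cong sum (map-allFin (suc K) u) ⟩
    sum (applyUpTo u (suc K))
      ≡⟨ sum-stepℕ (D 0 xor εpos x) K b h b≤K ⟩
    sumBelow h (K ∸ b) + (if D 0 xor εpos x then h (K ∸ b) else 0)
      ≡⟨ cong (λ e → sumBelow h (K ∸ b) + (if D 0 xor e then h (K ∸ b) else 0)) εpos≡parity ⟩
    extend (D 0) h (K ∸ b)
      ∎
    where
    open ≡-Reasoning
    K = 2 * k
    b = toℕ x
    h = completions (D ∘ suc) n
    u : ℕ → ℕ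
    u c = if stepℕ (D 0 xor εpos x) b c then h (K ∸ c) else 0
    b≤K : b ≤ K
    b≤K = Fin.toℕ≤pred[n] x
    -- T_k has 2k + 1 elements, so an index and its distance from the top have the same parity.
    εpos≡parity : εpos x ≡ isEven (K ∸ b)
    εpos≡parity = trans (εpos≡isEven x) (sym (isEven-2*∸ k b b≤K))

  Ω′B≡completions : ∀ {n} (π : SignedPerm n) k → Ω′B π k ≡ completions (isDes π) n (2 * k)
  Ω′B≡completions {n} π k =
    trans (cong length (filterᵇ-cong (admissible≡isChain k π) (allVecs (allT k) n)))
          (chainsFrom≡completions k (isDes π) n zero)

module Peaks where

  open Completions using (indicator; peaks)
  open FilterCounting using (length-filterᵇ-∷)
  open import Data.Bool.Base using (Bool; true; false; not; _∧_)
  open import Data.Fin.Base using (toℕ; fromℕ<)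
  import Data.Fin.Properties as Fin
  open import Data.Fin.Permutation using (_⟨$⟩ʳ_; _⟨$⟩ˡ_; inverseˡ)
  open import Data.Integer.Base using (ℤ; +_; ∣_∣)
  import Data.Integer.Properties as ℤ
  open import Data.List.Base using (applyUpTo; filterᵇ; length)
  open import Data.List.Properties using (map-upTo)
  open import Data.Nat.Base as ℕ using (ℕ; zero; suc; _+_; _<_; z≤n; s≤s)
  import Data.Nat.Properties as ℕ
  open import Data.Product.Base using (proj₁; proj₂)
  open import Function.Base using (_∘_)
  open import Relation.Binary.Definitions using (tri<; tri≈; tri>)
  open import Relation.Binary.PropositionalEquality
  open import Relation.Nullary using (yes; no; contradiction)
  open import Relation.Nullary.Decidable using (dec-true; dec-false)

  <ᵇℤ-flip : ∀ {x y : ℤ} → x ≢ y → (x <ᵇℤ y) ≡ not (y <ᵇℤ x)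
  <ᵇℤ-flip {x} {y} x≢y with ℤ.<-cmp x y
  ... | tri< x<y _ y≮x = trans (dec-true (x ℤ.<? y) x<y) (cong not (sym (dec-false (y ℤ.<? x) y≮x)))
  ... | tri≈ _ x≡y _   = contradiction x≡y x≢y
  ... | tri> x≮y _ y<x = trans (dec-false (x ℤ.<? y) x≮y) (cong not (sym (dec-true (y ℤ.<? x) y<x)))

  length-filterᵇ≡peaks : ∀ D (p : ℕ → Bool) (f : ℕ → ℕ) m → (∀ j → j < m → p (f j) ≡ not (D j) ∧ D (suc j)) →
                         length (filterᵇ p (applyUpTo f m)) ≡ peaks D (suc m)
  length-filterᵇ≡peaks D p f zero    _ with D 0
  ... | true  = refl
  ... | false = refl
  length-filterᵇ≡peaks D p f (suc m) p≡ =
    trans (length-filterᵇ-∷ p (f 0) (applyUpTo (f ∘ suc) m))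
          (cong₂ _+_ (cong indicator (p≡ 0 (s≤s z≤n)))
                     (length-filterᵇ≡peaks (D ∘ suc) p (f ∘ suc) m (λ j j<m → p≡ (suc j) (s≤s j<m))))

  module _ {n} (π : SignedPerm n) where
    private
      σ = proj₁ π

    ∣entry∣ : ∀ i → ∣ entry π i ∣ ≡ suc (toℕ (σ ⟨$⟩ʳ i))
    ∣entry∣ i with proj₂ π i
    ... | true  = refl
    ... | false = refl

    entry≢0 : ∀ i → entry π i ≢ + 0
    entry≢0 i eq = ℕ.1+n≢0 (trans (sym (∣entry∣ i)) (cong ∣_∣ eq))

    entry-injective : ∀ {i j} → entry π i ≡ entry π j → i ≡ j
    entry-injective {i} {j} eq = begin
      i                   ≡⟨ inverseˡ σ ⟨
      σ ⟨$⟩ˡ (σ ⟨$⟩ʳ i)   ≡⟨ cong (σ ⟨$⟩ˡ_) (Fin.toℕ-injective (ℕ.suc-injective ∣σi∣≡∣σj∣)) ⟩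
      σ ⟨$⟩ˡ (σ ⟨$⟩ʳ j)   ≡⟨ inverseˡ σ ⟩
      j                   ∎
      where
      open ≡-Reasoning
      ∣σi∣≡∣σj∣ = trans (sym (∣entry∣ i)) (trans (cong ∣_∣ eq) (∣entry∣ j))

    val-suc : ∀ j (j<n : j < n) → val π (suc j) ≡ entry π (fromℕ< j<n)
    val-suc j j<n with j ℕ.<? n
    ... | yes _   = refl
    ... | no  j≮n = contradiction j<n j≮n

    val-distinct : ∀ j → j < n → val π j ≢ val π (suc j)
    val-distinct zero    0<n   eq = entry≢0 _ (sym (trans eq (val-suc 0 0<n)))
    val-distinct (suc j) j+1<n eq =
      ℕ.1+n≢n (sym (Fin.fromℕ<-injective j (suc j) j<n j+1<n
                 (entry-injective (trans (sym (val-suc j j<n)) (trans eq (val-suc (suc j) j+1<n))))))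
      where
      j<n = ℕ.<-trans (ℕ.n<1+n j) j+1<n

  peB≡peaks : ∀ {m} (π : SignedPerm (suc m)) → peB π ≡ peaks (isDes π) (suc m)
  peB≡peaks {m} π =
    trans (cong (length ∘ filterᵇ (isPeak π)) (map-upTo suc m))
          (length-filterᵇ≡peaks (isDes π) (isPeak π) suc m ascent-then-descent)
    where
    ascent-then-descent : ∀ j → j < m → isPeak π (suc j) ≡ not (isDes π j) ∧ isDes π (suc j)
    ascent-then-descent j j<m =
      cong (_∧ isDes π (suc j)) (<ᵇℤ-flip (val-distinct π j (ℕ.<-trans j<m (ℕ.n<1+n m))))

open Completions using (completions; peaks; 2*≡double)
open ClosedForm using (closedForm)
open GeneratingFunction using (evenPart; completions-closedForm)
open ChainCounting using (Ω′B≡completions)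
open Peaks using (peB≡peaks)
open import Data.Integer using (+_)
open import Data.Nat using (ℕ; suc; _*_; _≥_)
open import Data.Product.Base using (proj₁)
open import Function.Base using (_∘_)
open import Relation.Binary.PropositionalEquality using (_≡_; cong; module ≡-Reasoning)

theorem4p12 : (n : ℕ) → n ≥ 1 → (π : SignedPerm n) → (k : ℕ) →
    + Ω′B π k ≡ rhsSeries π k
theorem4p12 (suc m) _ π k = begin
  + Ω′B π k                                        ≡⟨ cong +_ (Ω′B≡completions π k) ⟩
  + completions D (suc m) (2 * k)                  ≡⟨ cong (+_ ∘ completions D (suc m)) (2*≡double k) ⟩
  evenPart (completions D (suc m)) k               ≡⟨ proj₁ (completions-closedForm D (suc m)) k ⟩
  closedForm (suc m) (vsig π) (peaks D (suc m)) k  ≡⟨ cong (λ p → closedForm (suc m) (vsig π) p k) (peB≡peaks π) ⟨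
  rhsSeries π k                                    ∎
  where
  open ≡-Reasoning
  D = isDes π
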